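{- Let $a,b$ be integers with $b(a^2-4b)\ne0$, let $p>3$ be a prime with $p\mid b$ and $p\nmid a$, and let $d$ be a square-free Hall divisor of $a^2-4b$ (i.e. $d\mid a^2-4b$ with $\gcd(d,(a^2-4b)/d)=1$). Then $C_{d,(a^2-4b)/d,-2a}(\mathbb{Q}_p)=\emptyset$ if and only if both (i) $\left(\frac{d}{p}\right)=-1$, and (ii) $\nu_p(b)$ is odd or $\left(\frac{a}{p}\right)=1$.
   Context: For integers $d_1,d_2,F$, $C_{d_1,d_2,F}$ denotes the curve $Z^2=d_1U^4+FU^2V^2+d_2V^4$; $\left(\frac{\cdot}{p}\right)$ is the Legendre symbol and $\nu_p$ the $p$-adic valuation. -}

module Defs where

open import Data.Nat as ℕ using (ℕ; zero; suc)
open import Data.Nat.Primality using (Prime)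
open import Data.Nat.Divisibility as ℕD using ()
open import Data.Integer as ℤ using (ℤ; +_; _+_; _-_; _*_; _^_; ∣_∣; -_)
open import Data.Integer.Divisibility using (_∣_)
open import Data.Integer.GCD using (gcd)
open import Data.List using (upTo)
open import Data.Bool.ListAction using (any)
open import Data.Bool using (Bool; true; false; if_then_else_)
open import Data.Product using (Σ; _×_; ∃)
open import Relation.Nullary using (¬_; does)
open import Relation.Binary.PropositionalEquality using (_≡_)

isSquareMod : ℤ → ℕ → Bool
isSquareMod d p = any (λ x → does (p ℕD.∣? ∣ (+ x) * (+ x) - d ∣)) (upTo p)

legendre : ℤ → ℕ → ℤ
legendre d p =
  if does (p ℕD.∣? ∣ d ∣) then + 0
  else (if isSquareMod d p then + 1 else - (+ 1))

-- ν_p(b) = k  (for b ≠ 0): p^k ∣ b and p^(k+1) ∤ b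
ValuationIs : ℕ → ℤ → ℕ → Set
ValuationIs p b k = ((+ p) ^ k ∣ b) × ¬ ((+ p) ^ suc k ∣ b)

SquareFree : ℤ → Set
SquareFree d = ∀ (m : ℤ) → m * m ∣ d → ∣ m ∣ ≡ 1

-- The p-adic integers ℤ_p as the inverse limit of ℤ/p^n:
-- a sequence of integers x n (representing x mod p^n) with x (n+1) ≡ x n mod p^n.
record ℤₚ (p : ℕ) : Set where
  field
    digitSeq : ℕ → ℤ
    compat   : ∀ n → (+ p) ^ n ∣ (digitSeq (suc n) - digitSeq n)
open ℤₚ public

-- C_{d1,d2,F}(ℚ_p) ≠ ∅ : the curve Z² = d1 U⁴ + F U² V² + d2 V⁴ (in weighted
-- projective space with weights (1,1,2)) has a ℚ_p-point.  After scaling,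
-- every such point is represented by (u,v,z) ∈ ℤ_p³ with u,v not both
-- divisible by p; the equation holds in ℤ_p, i.e. modulo p^n for every n.
HasQpPoint : ℕ → ℤ → ℤ → ℤ → Set
HasQpPoint p d1 d2 F =
  Σ (ℤₚ p) λ u → Σ (ℤₚ p) λ v → Σ (ℤₚ p) λ z →
    (¬ (((+ p) ∣ digitSeq u 1) × ((+ p) ∣ digitSeq v 1))) ×
    (∀ n → let U = digitSeq u n ; V = digitSeq v n ; Z = digitSeq z n in
      (+ p) ^ n ∣ (Z * Z - (d1 * (U ^ 4) + F * (U * U) * (V * V) + d2 * (V ^ 4))))

OddNat : ℕ → Set
OddNat k = ∃ λ m → k ≡ suc (2 ℕ.* m)

{-# OPTIONS --safe #-}
module Submission where

-- Write W = dU² − aV². Since de = a² − 4b, completing the square gives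
-- d (Z² − dU⁴ + 2aU²V² − eV⁴) = dZ² − W² + 4bV⁴, and p ∤ d because p ∣ b and p ∤ a.
-- If d is a square mod p, Hensel's lemma lifts the point (1 : 0 : √d).
-- If d is not a square, W² − dZ² is anisotropic mod p, so on a primitive point p ∣ W and p ∣ Z,
-- hence p ∤ V. A root t of a mod p then gives (tV)² ≡ dU², forcing p ∣ U and p ∣ V; and if
-- ν_p(b) = 2m + 1, then p^(2m+1) ∣ W² − dZ² forces p^(m+1) ∣ W, Z, so p^(2m+2) ∣ 4bV⁴, which is
-- impossible. Conversely, if ν_p(b) = 2K is even and a is not a square, then a/d is a square and
-- d represents W₀² − 4b/p^(2K) for some W₀ (both by counting squares mod p); Hensel's lemma
-- then solves dU² = a + p^K W₀ and dY² = W₀² − 4b/p^(2K), and (U : 1 : p^K Y) is a point.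

open import Data.Bool using (true; false; T)
open import Data.Bool.ListAction using (any)
open import Data.Fin as Fin using (Fin; toℕ; fromℕ<; splitAt)
import Data.Fin.Properties as Finₚ
open import Data.Integer as ℤ using (ℤ; +_; _+_; _*_; -_; _-_; _^_; ∣_∣)
open import Data.Integer.Divisibility using (_∣_)
open import Data.Integer.Divisibility.Signed as Signed using (divides; ∣ᵤ⇒∣; ∣⇒∣ᵤ)
  renaming (_∣_ to _∣ₛ_)
import Data.Integer.DivMod as ℤ
open import Data.Integer.GCD using (gcd)
import Data.Integer.Properties as ℤP
open import Algebra.Properties.AbelianGroup ℤP.+-0-abelianGroup using (xyx⁻¹≈y; ⁻¹-anti-homo‿-)
open import Data.Integer.Tactic.RingSolver using (solve-∀)
open import Data.List using (upTo)
open import Data.List.Membership.Propositional using (lose)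
open import Data.List.Membership.Propositional.Properties using (∈-upTo⁺)
open import Data.List.Relation.Unary.Any using (satisfied)
open import Data.List.Relation.Unary.Any.Properties using (any⁺; any⁻)
open import Data.Nat as ℕ using (ℕ; zero; suc; z≤n; s≤s)
open import Data.Nat.Coprimality using (Coprime; coprime-Bézout)
import Data.Nat.Divisibility as ℕ
open import Data.Nat.GCD using (module Bézout)
open import Data.Nat.Primality using (Prime; euclidsLemma; prime⇒irreducible; prime⇒nonZero)
import Data.Nat.Properties as ℕP
open import Data.Product as Product using (Σ; ∃; ∃₂; ∃-syntax; _×_; _,_; proj₁; proj₂)
open import Data.Sum as Sum using (_⊎_; inj₁; inj₂; [_,_]′)
open import Function using (_∘_; id; flip)
open import Function.Bundles using (_⇔_; mk⇔)
open import Relation.Binary.PropositionalEquality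
open import Relation.Nullary using (¬_; Dec; yes; no; contradiction)
open import Relation.Nullary.Decidable using (decidable-stable; toWitness; isYes≗does; dec-true)

open import Defs

∣ₛ-respʳ : ∀ {k x y} → x ≡ y → k ∣ₛ x → k ∣ₛ y
∣ₛ-respʳ refl k∣x = k∣x

∣ₛ-lincomb : ∀ {k x y z} r s → k ∣ₛ x → k ∣ₛ y → z ≡ r * x + s * y → k ∣ₛ z
∣ₛ-lincomb r s k∣x k∣y z≡ =
  ∣ₛ-respʳ (sym z≡) (Signed.∣m∣n⇒∣m+n (Signed.∣n⇒∣m*n r k∣x) (Signed.∣n⇒∣m*n s k∣y))

∣ₛ-sub-sym : ∀ {k} x y → k ∣ₛ x - y → k ∣ₛ y - x
∣ₛ-sub-sym x y k∣x-y = ∣ₛ-respʳ (⁻¹-anti-homo‿- x y) (Signed.∣m⇒∣-m k∣x-y)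

*-pres-∣ₛ : ∀ {i j m n} → i ∣ₛ m → j ∣ₛ n → i * j ∣ₛ m * n
*-pres-∣ₛ {i} {j} (divides q refl) (divides r refl) = divides (q * r) (rearrange q i r j)
  where
  rearrange : ∀ q i r j → q * i * (r * j) ≡ q * r * (i * j)
  rearrange = solve-∀

1∣ₛn : ∀ n → + 1 ∣ₛ n
1∣ₛn n = divides n (sym (ℤP.*-identityʳ n))

k∣k^[1+n] : ∀ k n → k ∣ₛ k ^ suc n
k∣k^[1+n] k n = Signed.∣m⇒∣m*n (k ^ n) Signed.∣-refl

m-[m-n]≡n : ∀ m n → m - (m - n) ≡ n
m-[m-n]≡n = solve-∀

x^4≡x²*x² : ∀ x → x ^ 4 ≡ x * x * (x * x)
x^4≡x²*x² x = trans (ℤP.^-distribˡ-+-* x 2 2) (cong₂ _*_ x^2≡x*x x^2≡x*x)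
  where
  x^2≡x*x : x ^ 2 ≡ x * x
  x^2≡x*x = cong (x *_) (ℤP.*-identityʳ x)

lift-ℕ-identity : ∀ {u v w x y} → u ℕ.+ v ℕ.* w ≡ x ℕ.* y → + u + + v * + w ≡ + x * + y
lift-ℕ-identity {u} {v} {w} {x} {y} eq = begin
  + u + + v * + w   ≡⟨ cong (_+_ (+ u)) (ℤP.pos-* v w) ⟨
  + (u ℕ.+ v ℕ.* w) ≡⟨ cong +_ eq ⟩
  + (x ℕ.* y)       ≡⟨ ℤP.pos-* x y ⟩
  + x * + y         ∎
  where open ≡-Reasoning

even⊎odd : ∀ k → (∃[ m ] k ≡ 2 ℕ.* m) ⊎ OddNat k
even⊎odd zero = inj₁ (0 , refl)
even⊎odd (suc k) with even⊎odd k
... | inj₁ (m , k≡2m)   = inj₂ (m , cong suc k≡2m)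
... | inj₂ (m , k≡1+2m) = inj₁ (suc m , trans (cong suc k≡1+2m) (sym (ℕP.*-suc 2 m)))

-- p-adic integers

module _ {p : ℕ} where

  constant : ℤ → ℤₚ p
  constant c = record
    { digitSeq = λ _ → c
    ; compat   = λ n → subst ((+ p) ^ n ∣_) (sym (ℤP.+-inverseʳ c)) (ℕ._∣0 ∣ (+ p) ^ n ∣)
    }

  compatₛ : (x : ℤₚ p) → ∀ n → (+ p) ^ n ∣ₛ digitSeq x (suc n) - digitSeq x n
  compatₛ x n = ∣ᵤ⇒∣ {(+ p) ^ n} (compat x n)

  scale : ℤ → ℤₚ p → ℤₚ p
  scale k x = record
    { digitSeq = λ n → k * digitSeq x n
    ; compat   = λ n → ∣⇒∣ᵤ (∣ₛ-respʳ (k[x-y]≡kx-ky k (digitSeq x (suc n)) (digitSeq x n))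
                                     (Signed.∣n⇒∣m*n k (compatₛ x n)))
    }
    where
    k[x-y]≡kx-ky : ∀ k x y → k * (x - y) ≡ k * x - k * y
    k[x-y]≡kx-ky = solve-∀

  P∣digit[1+n]-digit₁ : (x : ℤₚ p) → ∀ n → + p ∣ₛ digitSeq x (suc n) - digitSeq x 1
  P∣digit[1+n]-digit₁ x zero    = ∣ₛ-respʳ (sym (ℤP.+-inverseʳ (digitSeq x 1))) (∣ᵤ⇒∣ (ℕ._∣0 p))
  P∣digit[1+n]-digit₁ x (suc n) =
    ∣ₛ-respʳ (ℤP.+-minus-telescope (digitSeq x (suc (suc n))) (digitSeq x (suc n)) (digitSeq x 1))
      (Signed.∣m∣n⇒∣m+n (Signed.∣-trans (k∣k^[1+n] (+ p) n) (compatₛ x (suc n)))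
                        (P∣digit[1+n]-digit₁ x n))

  P∣digit[1+n]⇒P∣digit₁ : (x : ℤₚ p) → ∀ n → + p ∣ₛ digitSeq x (suc n) → + p ∣ₛ digitSeq x 1
  P∣digit[1+n]⇒P∣digit₁ x n P∣x[1+n] = ∣ₛ-respʳ (m-[m-n]≡n (digitSeq x (suc n)) (digitSeq x 1))
    (Signed.∣m∣n⇒∣m-n P∣x[1+n] (P∣digit[1+n]-digit₁ x n))

-- Arithmetic modulo an odd prime

module ModPrime (p : ℕ) (p-prime : Prime p) (2<p : 2 ℕ.< p) where

  open ≡-Reasoning

  P : ℤ
  P = + p

  instance
    p≢0 : ℕ.NonZero p
    p≢0 = prime⇒nonZero p-prime

  1<p : 1 ℕ.< p
  1<p = ℕP.<-trans (ℕP.n<1+n 1) 2<p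

  P∤+n : ∀ n .{{_ : ℕ.NonZero n}} → n ℕ.< p → ¬ P ∣ₛ + n
  P∤+n n n<p = ℕ.>⇒∤ n<p ∘ ∣⇒∣ᵤ

  P∣+n⇒n≡0 : ∀ {n} → n ℕ.< p → P ∣ₛ + n → n ≡ 0
  P∣+n⇒n≡0 {zero}  _   _   = refl
  P∣+n⇒n≡0 {suc n} n<p P∣n = contradiction P∣n (P∤+n (suc n) n<p)

  P∤1 : ¬ P ∣ₛ + 1
  P∤1 = P∤+n 1 1<p

  P∤2 : ¬ P ∣ₛ + 2
  P∤2 = P∤+n 2 2<p

  P∣x*y⇒P∣x⊎P∣y : ∀ x y → P ∣ₛ x * y → P ∣ₛ x ⊎ P ∣ₛ y
  P∣x*y⇒P∣x⊎P∣y x y P∣xy = Sum.map ∣ᵤ⇒∣ ∣ᵤ⇒∣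
    (euclidsLemma ∣ x ∣ ∣ y ∣ p-prime (subst (p ℕ.∣_) (ℤP.abs-* x y) (∣⇒∣ᵤ P∣xy)))

  P∤x*y : ∀ {x y} → ¬ P ∣ₛ x → ¬ P ∣ₛ y → ¬ P ∣ₛ x * y
  P∤x*y P∤x P∤y = [ P∤x , P∤y ]′ ∘ P∣x*y⇒P∣x⊎P∣y _ _

  P∣x*x⇒P∣x : ∀ {x} → P ∣ₛ x * x → P ∣ₛ x
  P∣x*x⇒P∣x P∣xx = Sum.reduce (P∣x*y⇒P∣x⊎P∣y _ _ P∣xx)

  P∤4 : ¬ P ∣ₛ + 4
  P∤4 = P∤x*y P∤2 P∤2

  P∣P^[1+n] : ∀ n → P ∣ₛ P ^ suc n
  P∣P^[1+n] = k∣k^[1+n] P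

  P^m∣P^n : ∀ {m n} → m ℕ.≤ n → P ^ m ∣ₛ P ^ n
  P^m∣P^n {n = n} z≤n       = 1∣ₛn (P ^ n)
  P^m∣P^n         (s≤s m≤n) = Signed.*-monoʳ-∣ P (P^m∣P^n m≤n)

  P^[1+n]∣⇒P^n∣ : ∀ n {x} → P ^ suc n ∣ₛ x → P ^ n ∣ₛ x
  P^[1+n]∣⇒P^n∣ n = Signed.∣-trans (P^m∣P^n (ℕP.n≤1+n n))

  P^[1+n]∣⇒P∣ : ∀ n {x} → P ^ suc n ∣ₛ x → P ∣ₛ x
  P^[1+n]∣⇒P∣ n = Signed.∣-trans (P∣P^[1+n] n)

  P∣⇒P^1∣ : ∀ {x} → P ∣ₛ x → P ^ 1 ∣ₛ x
  P∣⇒P^1∣ {x} = subst (_∣ₛ x) (sym (ℤP.^-identityʳ P))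

  P^1∣⇒P∣ : ∀ {x} → P ^ 1 ∣ₛ x → P ∣ₛ x
  P^1∣⇒P∣ {x} = subst (_∣ₛ x) (ℤP.^-identityʳ P)

  P^[2m]≡P^m*P^m : ∀ m → P ^ (2 ℕ.* m) ≡ P ^ m * P ^ m
  P^[2m]≡P^m*P^m m =
    trans (cong (λ k → P ^ (m ℕ.+ k)) (ℕP.+-identityʳ m)) (ℤP.^-distribˡ-+-* P m m)

  P^m∣x⇒P^[2m]∣x*x : ∀ m {x} → P ^ m ∣ₛ x → P ^ (2 ℕ.* m) ∣ₛ x * x
  P^m∣x⇒P^[2m]∣x*x m P^m∣x =
    subst (_∣ₛ _) (sym (P^[2m]≡P^m*P^m m)) (*-pres-∣ₛ P^m∣x P^m∣x)

  P^m∣x⇒P∣y⇒P^[1+m]∣x*y : ∀ m {x y} → P ^ m ∣ₛ x → P ∣ₛ y → P ^ suc m ∣ₛ x * y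
  P^m∣x⇒P∣y⇒P^[1+m]∣x*y m P^m∣x P∣y =
    subst (_∣ₛ _) (ℤP.*-comm (P ^ m) P) (*-pres-∣ₛ P^m∣x P∣y)

  P^n∣x*y⇒P^n∣y : ∀ n {x y} → ¬ P ∣ₛ x → P ^ n ∣ₛ x * y → P ^ n ∣ₛ y
  P^n∣x*y⇒P^n∣y zero          _   _      = 1∣ₛn _
  P^n∣x*y⇒P^n∣y (suc n) {x} {y} P∤x P^n∣xy
    with P∣x*y⇒P∣x⊎P∣y x y (P^[1+n]∣⇒P∣ n P^n∣xy)
  ... | inj₁ P∣x              = contradiction P∣x P∤x
  ... | inj₂ (divides q refl) = ∣ₛ-respʳ (ℤP.*-comm P q) (Signed.*-monoʳ-∣ P P^n∣q)
    where
    x*[q*P]≡P*[x*q] : ∀ x q P → x * (q * P) ≡ P * (x * q)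
    x*[q*P]≡P*[x*q] = solve-∀
    P^n∣q : P ^ n ∣ₛ q
    P^n∣q = P^n∣x*y⇒P^n∣y n P∤x
      (Signed.*-cancelˡ-∣ P (∣ₛ-respʳ (x*[q*P]≡P*[x*q] x q P) P^n∣xy))

  P^[1+n]∣P^n*x⇒P∣x : ∀ n {x} → P ^ suc n ∣ₛ P ^ n * x → P ∣ₛ x
  P^[1+n]∣P^n*x⇒P∣x zero    {x} P^1∣x = ∣ₛ-respʳ (ℤP.*-identityˡ x) (P^1∣⇒P∣ P^1∣x)
  P^[1+n]∣P^n*x⇒P∣x (suc n) {x} P^[2+n]∣P^[1+n]x = P^[1+n]∣P^n*x⇒P∣x n
    (Signed.*-cancelˡ-∣ P (∣ₛ-respʳ (ℤP.*-assoc P (P ^ n) x) P^[2+n]∣P^[1+n]x))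

  p∤n⇒coprime : ∀ {n} → ¬ p ℕ.∣ n → Coprime p n
  p∤n⇒coprime p∤n (i∣p , i∣n) with prime⇒irreducible p-prime i∣p
  ... | inj₁ i≡1  = i≡1
  ... | inj₂ refl = contradiction i∣n p∤n

  inverseℕ : ∀ {n} → ¬ p ℕ.∣ n → ∃[ w ] P ∣ₛ + n * w - + 1
  inverseℕ {n} p∤n with coprime-Bézout (p∤n⇒coprime p∤n)
  ... | Bézout.+- x y 1+yn≡xp = - + y , divides (- + x) (begin
    + n * - + y - + 1    ≡⟨ n*-y-1≡-[1+yn] (+ n) (+ y) ⟩
    - (+ 1 + + y * + n)  ≡⟨ cong -_ (lift-ℕ-identity {1} {y} {n} {x} {p} 1+yn≡xp) ⟩
    - (+ x * P)          ≡⟨ ℤP.neg-distribˡ-* (+ x) P ⟩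
    - + x * P            ∎)
    where
    n*-y-1≡-[1+yn] : ∀ n y → n * - y - + 1 ≡ - (+ 1 + y * n)
    n*-y-1≡-[1+yn] = solve-∀
  ... | Bézout.-+ x y 1+xp≡yn = + y , divides (+ x) (begin
    + n * + y - + 1      ≡⟨ cong (_- + 1) (ℤP.*-comm (+ n) (+ y)) ⟩
    + y * + n - + 1      ≡⟨ cong (_- + 1) (lift-ℕ-identity {1} {x} {p} {y} {n} 1+xp≡yn) ⟨
    + 1 + + x * P - + 1  ≡⟨ xyx⁻¹≈y (+ 1) (+ x * P) ⟩
    + x * P              ∎)

  inverse : ∀ {x} → ¬ P ∣ₛ x → ∃[ w ] P ∣ₛ x * w - + 1
  inverse {x} P∤x with inverseℕ (P∤x ∘ ∣ᵤ⇒∣) | Signed.m∣∣m∣ {x}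
  ... | w , P∣∣x∣w-1 | divides s ∣x∣≡sx = s * w , ∣ₛ-respʳ (reassoc s x w)
    (subst (λ m → P ∣ₛ m * w - + 1) ∣x∣≡sx P∣∣x∣w-1)
    where
    reassoc : ∀ s x w → s * x * w - + 1 ≡ x * (s * w) - + 1
    reassoc = solve-∀

  residue : ℤ → ℕ
  residue x = x ℤ.%ℕ p

  P∣x-residue : ∀ x → P ∣ₛ x - + residue x
  P∣x-residue x = divides (x ℤ./ℕ p) (begin
    x - + residue x                           ≡⟨ cong (_- + residue x) (ℤ.a≡a%ℕn+[a/ℕn]*n x p) ⟩
    + residue x + x ℤ./ℕ p * P - + residue x  ≡⟨ xyx⁻¹≈y (+ residue x) (x ℤ./ℕ p * P) ⟩
    x ℤ./ℕ p * P                              ∎)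

  residue≡⇒P∣ : ∀ x y → residue x ≡ residue y → P ∣ₛ x - y
  residue≡⇒P∣ x y r≡ = ∣ₛ-respʳ (telescope x y (+ residue x))
    (Signed.∣m∣n⇒∣m-n (P∣x-residue x) (subst (λ r → P ∣ₛ y - + r) (sym r≡) (P∣x-residue y)))
    where
    telescope : ∀ x y r → x - r - (y - r) ≡ x - y
    telescope = solve-∀

  P∣[i-j]⇒i≡j : ∀ {i j} → i ℕ.< p → j ℕ.< p → P ∣ₛ + i - + j → i ≡ j
  P∣[i-j]⇒i≡j {i} {j} i<p j<p P∣i-j =
    [ (λ i≤j → ordered i≤j j<p (∣ₛ-sub-sym (+ i) (+ j) P∣i-j))
    , (λ j≤i → sym (ordered j≤i i<p P∣i-j))
    ]′ (ℕP.≤-total i j)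
    where
    ordered : ∀ {i j} → i ℕ.≤ j → j ℕ.< p → P ∣ₛ + j - + i → i ≡ j
    ordered {i} {j} i≤j j<p P∣j-i = ℕP.≤-antisym i≤j (ℕP.m∸n≡0⇒m≤n
      (P∣+n⇒n≡0 (ℕP.≤-<-trans (ℕP.m∸n≤m j i) j<p)
                (∣ₛ-respʳ (trans (ℤP.m-n≡m⊖n j i) (ℤP.≤-⊖ i≤j)) P∣j-i)))

  -- Squares modulo p

  SquareMod : ℤ → Set
  SquareMod c = ∃[ x ] P ∣ₛ x * x - c

  NonSquareMod : ℤ → Set
  NonSquareMod c = ¬ SquareMod c

  isSquareMod-sound : ∀ c → T (isSquareMod c p) → SquareMod c
  isSquareMod-sound c t with satisfied (any⁻ _ (upTo p) t)
  ... | x , Tx = + x , ∣ᵤ⇒∣ (toWitness (subst T (sym (isYes≗does (p ℕ.∣? ∣ + x * + x - c ∣))) Tx))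

  isSquareMod-complete : ∀ c → SquareMod c → T (isSquareMod c p)
  isSquareMod-complete c (x , P∣x²-c) = any⁺ _ (lose (∈-upTo⁺ (ℤ.n%ℕd<d x p))
    (subst T (sym (dec-true (p ℕ.∣? ∣ r * r - c ∣) (∣⇒∣ᵤ P∣r²-c))) _))
    where
    r = + residue x
    r²-c≡ : ∀ x r c → r * r - c ≡ + 1 * (x * x - c) + (- (x + r)) * (x - r)
    r²-c≡ = solve-∀
    P∣r²-c : P ∣ₛ r * r - c
    P∣r²-c = ∣ₛ-lincomb (+ 1) (- (x + r)) P∣x²-c (P∣x-residue x) (r²-c≡ x r c)

  data LegendreView (c : ℤ) : ℤ → Set where
    divisible      : P ∣ₛ c → LegendreView c (+ 0)
    nonzero-square : SquareMod c → LegendreView c (+ 1)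
    nonsquare      : NonSquareMod c → LegendreView c (- + 1)

  legendreView : ∀ c → LegendreView c (legendre c p)
  legendreView c with p ℕ.∣? ∣ c ∣ | isSquareMod c p in sq?
  ... | yes p∣c | _     = divisible (∣ᵤ⇒∣ p∣c)
  ... | no  _   | true  = nonzero-square (isSquareMod-sound c (subst T (sym sq?) _))
  ... | no  _   | false = nonsquare (subst T sq? ∘ isSquareMod-complete c)

  legendre≡1⇒square : ∀ {c} → legendre c p ≡ + 1 → SquareMod c
  legendre≡1⇒square {c} leg≡1 with legendre c p | legendreView c
  ... | _ | nonzero-square sq = sq
  ... | _ | divisible _       with () ← leg≡1
  ... | _ | nonsquare _       with () ← leg≡1

  legendre≡-1⇒nonSquare : ∀ {c} → legendre c p ≡ - + 1 → NonSquareMod c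
  legendre≡-1⇒nonSquare {c} leg≡-1 with legendre c p | legendreView c
  ... | _ | nonsquare nsq      = nsq
  ... | _ | divisible _        with () ← leg≡-1
  ... | _ | nonzero-square _   with () ← leg≡-1

  nonSquare⇒P∤ : ∀ {c} → NonSquareMod c → ¬ P ∣ₛ c
  nonSquare⇒P∤ {c} nsq P∣c =
    nsq (+ 0 , ∣ₛ-respʳ (sym (ℤP.+-identityˡ (- c))) (Signed.∣m⇒∣-m P∣c))

  nonSquare-anisotropic : ∀ {c} → NonSquareMod c → ∀ x y →
                          P ∣ₛ x * x - c * (y * y) → P ∣ₛ x × P ∣ₛ y
  nonSquare-anisotropic {c} nsq x y P∣x²-cy² = P∣x , P∣y
    where
    [xw]²-c≡ : ∀ x y w c → x * w * (x * w) - c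
               ≡ w * w * (x * x - c * (y * y)) + c * (y * w + + 1) * (y * w - + 1)
    [xw]²-c≡ = solve-∀
    P∣y : P ∣ₛ y
    P∣y = decidable-stable (P Signed.∣? y) λ P∤y →
      let w , P∣yw-1 = inverse P∤y in
      nsq (x * w , ∣ₛ-lincomb (w * w) (c * (y * w + + 1)) P∣x²-cy² P∣yw-1 ([xw]²-c≡ x y w c))
    x²≡ : ∀ x y c → x * x ≡ + 1 * (x * x - c * (y * y)) + c * y * y
    x²≡ = solve-∀
    P∣x : P ∣ₛ x
    P∣x = P∣x*x⇒P∣x (∣ₛ-lincomb (+ 1) (c * y) P∣x²-cy² P∣y (x²≡ x y c))

  nonSquare-anisotropic-^ : ∀ {c} → NonSquareMod c → ∀ m x y →
    P ^ suc (2 ℕ.* m) ∣ₛ x * x - c * (y * y) → P ^ suc m ∣ₛ x × P ^ suc m ∣ₛ y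
  nonSquare-anisotropic-^ nsq zero x y P^1∣N =
    Product.map P∣⇒P^1∣ P∣⇒P^1∣ (nonSquare-anisotropic nsq x y (P^1∣⇒P∣ P^1∣N))
  nonSquare-anisotropic-^ {c} nsq (suc m) x y P^[3+2m]∣N
    with nonSquare-anisotropic-^ nsq m x y
           (Signed.∣-trans (P^m∣P^n (s≤s (ℕP.*-monoʳ-≤ 2 (ℕP.n≤1+n m)))) P^[3+2m]∣N)
  ... | divides qx refl , divides qy refl =
    *-pres-∣ₛ P∣qx (Signed.∣-refl {Q}) , *-pres-∣ₛ P∣qy (Signed.∣-refl {Q})
    where
    Q = P ^ suc m
    N≡ : ∀ qx qy c Q → qx * Q * (qx * Q) - c * (qy * Q * (qy * Q))
                       ≡ Q * Q * (qx * qx - c * (qy * qy))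
    N≡ = solve-∀
    P∣qx²-cqy² : P ∣ₛ qx * qx - c * (qy * qy)
    P∣qx²-cqy² = P^[1+n]∣P^n*x⇒P∣x (2 ℕ.* suc m) (∣ₛ-respʳ
      (trans (N≡ qx qy c Q) (cong (_* _) (sym (P^[2m]≡P^m*P^m (suc m))))) P^[3+2m]∣N)
    P∣qx = proj₁ (nonSquare-anisotropic nsq qx qy P∣qx²-cqy²)
    P∣qy = proj₂ (nonSquare-anisotropic nsq qx qy P∣qx²-cqy²)

  p-odd : OddNat p
  p-odd with even⊎odd p
  ... | inj₂ odd = odd
  ... | inj₁ (m , p≡2m) with prime⇒irreducible p-prime (ℕ.divides m (trans p≡2m (ℕP.*-comm 2 m)))
  ...   | inj₂ 2≡p = contradiction 2≡p (ℕP.<⇒≢ 2<p)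

  half : ℕ
  half = proj₁ p-odd

  half<p : half ℕ.< p
  half<p = subst (half ℕ.<_) (sym (proj₂ p-odd)) (s≤s (ℕP.m≤m+n half _))

  i+j<p : ∀ {i j} → i ℕ.≤ half → j ℕ.≤ half → i ℕ.+ j ℕ.< p
  i+j<p {i} {j} i≤h j≤h = subst (i ℕ.+ j ℕ.<_) (sym (proj₂ p-odd))
    (s≤s (ℕP.+-mono-≤ i≤h (subst (j ℕ.≤_) (sym (ℕP.+-identityʳ half)) j≤h)))

  InjectiveMod : (ℕ → ℤ) → Set
  InjectiveMod f = ∀ {i j} → i ℕ.≤ half → j ℕ.≤ half → P ∣ₛ f i - f j → i ≡ j

  SelfCollision : (ℕ → ℤ) → Set
  SelfCollision g = ∃₂ λ i j → i ℕ.≤ half × j ℕ.≤ half × i ≢ j × P ∣ₛ g i - g j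

  Collision : (ℕ → ℤ) → (ℕ → ℤ) → Set
  Collision f g = ∃₂ λ i j → i ℕ.≤ half × j ℕ.≤ half × P ∣ₛ f i - g j

  pigeonhole-mod : ∀ f g → InjectiveMod f → SelfCollision g ⊎ Collision f g
  pigeonhole-mod f g f-inj =
    let k₁ , k₂ , k₁<k₂ , r≡ = Finₚ.pigeonhole p<N+N (λ k → fromℕ< (ℤ.n%ℕd<d (value′ k) p))
    in classify (splitAt N k₁) (splitAt N k₂) (distinct k₁<k₂)
         (residue≡⇒P∣ (value′ k₁) (value′ k₂) (Finₚ.fromℕ<-injective _ _ _ _ r≡))
    where
    N = suc half
    p<N+N : p ℕ.< N ℕ.+ N
    p<N+N = subst (ℕ._< N ℕ.+ N) (sym (proj₂ p-odd))
      (s≤s (ℕP.+-monoʳ-< half (s≤s (ℕP.≤-reflexive (ℕP.+-identityʳ half)))))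
    value : Fin N ⊎ Fin N → ℤ
    value = [ f ∘ toℕ , g ∘ toℕ ]′
    value′ : Fin (N ℕ.+ N) → ℤ
    value′ = value ∘ splitAt N
    ≤half : (i : Fin N) → toℕ i ℕ.≤ half
    ≤half i = ℕ.s≤s⁻¹ (Finₚ.toℕ<n i)
    distinct : ∀ {k₁ k₂} → k₁ Fin.< k₂ → splitAt N k₁ ≢ splitAt N k₂
    distinct {k₁} {k₂} k₁<k₂ eq = Finₚ.<⇒≢ k₁<k₂ (begin
      k₁                          ≡⟨ Finₚ.join-splitAt N N k₁ ⟨
      Fin.join N N (splitAt N k₁) ≡⟨ cong (Fin.join N N) eq ⟩
      Fin.join N N (splitAt N k₂) ≡⟨ Finₚ.join-splitAt N N k₂ ⟩
      k₂                          ∎)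
    classify : ∀ s t → s ≢ t → P ∣ₛ value s - value t → SelfCollision g ⊎ Collision f g
    classify (inj₁ a) (inj₁ b) s≢t P∣fa-fb =
      contradiction (cong inj₁ (Finₚ.toℕ-injective (f-inj (≤half a) (≤half b) P∣fa-fb))) s≢t
    classify (inj₂ a) (inj₂ b) s≢t P∣ga-gb =
      inj₁ (toℕ a , toℕ b , ≤half a , ≤half b , s≢t ∘ cong inj₂ ∘ Finₚ.toℕ-injective , P∣ga-gb)
    classify (inj₁ a) (inj₂ b) _ P∣fa-gb = inj₂ (toℕ a , toℕ b , ≤half a , ≤half b , P∣fa-gb)
    classify (inj₂ a) (inj₁ b) _ P∣ga-fb =
      inj₂ (toℕ b , toℕ a , ≤half b , ≤half a , ∣ₛ-sub-sym (g (toℕ a)) (f (toℕ b)) P∣ga-fb)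

  square : ℕ → ℤ
  square i = + i * + i

  square-injective : InjectiveMod square
  square-injective {i} {j} i≤h j≤h P∣i²-j² =
    [ P∣[i-j]⇒i≡j (<p i≤h) (<p j≤h) , P∣i+j⇒i≡j ]′
      (P∣x*y⇒P∣x⊎P∣y (+ i - + j) (+ i + + j) (∣ₛ-respʳ (x²-y²≡ (+ i) (+ j)) P∣i²-j²))
    where
    x²-y²≡ : ∀ x y → x * x - y * y ≡ (x - y) * (x + y)
    x²-y²≡ = solve-∀
    <p : ∀ {k} → k ℕ.≤ half → k ℕ.< p
    <p k≤h = ℕP.≤-<-trans k≤h half<p
    P∣i+j⇒i≡j : P ∣ₛ + (i ℕ.+ j) → i ≡ j
    P∣i+j⇒i≡j P∣i+j = trans (ℕP.m+n≡0⇒m≡0 i i+j≡0) (sym (ℕP.m+n≡0⇒n≡0 i i+j≡0))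
      where
      i+j≡0 : i ℕ.+ j ≡ 0
      i+j≡0 = P∣+n⇒n≡0 (i+j<p i≤h j≤h) P∣i+j

  P∣B*x-B*y⇒P∣x-y : ∀ {B} x y → ¬ P ∣ₛ B → P ∣ₛ B * x - B * y → P ∣ₛ x - y
  P∣B*x-B*y⇒P∣x-y {B} x y P∤B P∣Bx-By = [ flip contradiction P∤B , id ]′
    (P∣x*y⇒P∣x⊎P∣y B (x - y) (∣ₛ-respʳ (Bx-By≡ B x y) P∣Bx-By))
    where
    Bx-By≡ : ∀ B x y → B * x - B * y ≡ B * (x - y)
    Bx-By≡ = solve-∀

  x²≡c+By²-solvable : ∀ {B} c → ¬ P ∣ₛ B → ∃₂ λ x y → P ∣ₛ x * x - (c + B * (y * y))
  x²≡c+By²-solvable {B} c P∤B =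
    [ impossible , solution ]′ (pigeonhole-mod square g square-injective)
    where
    g : ℕ → ℤ
    g j = c + B * square j
    cancel : ∀ c x y → c + x - (c + y) ≡ x - y
    cancel = solve-∀
    impossible : SelfCollision g → ∃₂ λ x y → P ∣ₛ x * x - (c + B * (y * y))
    impossible (i , j , i≤h , j≤h , i≢j , P∣gi-gj) =
      contradiction (square-injective i≤h j≤h (P∣B*x-B*y⇒P∣x-y (square i) (square j) P∤B
        (∣ₛ-respʳ (cancel c (B * square i) (B * square j)) P∣gi-gj))) i≢j
    solution : Collision square g → ∃₂ λ x y → P ∣ₛ x * x - (c + B * (y * y))
    solution (i , j , _ , _ , P∣i²-gj) = + i , + j , P∣i²-gj

  nonSquare-ratio-square : ∀ {a d} → NonSquareMod a → NonSquareMod d →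
                           ∃[ t ] P ∣ₛ d * (t * t) - a
  nonSquare-ratio-square {a} {d} nsq-a nsq-d =
    [ within , across ]′ (pigeonhole-mod square g square-injective)
    where
    g : ℕ → ℤ
    g zero    = a
    g (suc j) = d * square (suc j)
    within : SelfCollision g → ∃[ t ] P ∣ₛ d * (t * t) - a
    within (zero  , zero  , _ , _ , 0≢0 , _)         = contradiction refl 0≢0
    within (zero  , suc j , _ , _ , _ , P∣a-d[1+j]²) =
      + suc j , ∣ₛ-sub-sym a (d * square (suc j)) P∣a-d[1+j]²
    within (suc i , zero  , _ , _ , _ , P∣d[1+i]²-a) = + suc i , P∣d[1+i]²-a
    within (suc i , suc j , i≤h , j≤h , i≢j , P∣gi-gj) =
      contradiction (square-injective i≤h j≤h
        (P∣B*x-B*y⇒P∣x-y (square (suc i)) (square (suc j)) (nonSquare⇒P∤ nsq-d) P∣gi-gj)) i≢j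
    across : Collision square g → ∃[ t ] P ∣ₛ d * (t * t) - a
    across (i , zero  , _ , _ , P∣i²-a)         = contradiction (+ i , P∣i²-a) nsq-a
    across (i , suc j , _ , j≤h , P∣i²-d[1+j]²) =
      contradiction (proj₂ (nonSquare-anisotropic nsq-d (+ i) (+ suc j) P∣i²-d[1+j]²))
                    (P∤+n (suc j) (ℕP.≤-<-trans j≤h half<p))

  nonSquare-represented : ∀ {c B} → NonSquareMod c → ¬ P ∣ₛ B →
                          ∃₂ λ s r → ¬ P ∣ₛ r × P ∣ₛ c * (r * r) - (s * s - B)
  nonSquare-represented {c} {B} nsq P∤B = represent (x²≡c+By²-solvable c P∤B)
    where
    x²-c≡ : ∀ x c B y → x * x - c ≡ + 1 * (x * x - (c + B * (y * y))) + B * y * y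
    x²-c≡ = solve-∀
    cw²-[[xw]²-B]≡ : ∀ c B x y w → c * (w * w) - (x * w * (x * w) - B)
      ≡ - (w * w) * (x * x - (c + B * (y * y))) + - (B * (y * w + + 1)) * (y * w - + 1)
    cw²-[[xw]²-B]≡ = solve-∀
    represent : (∃₂ λ x y → P ∣ₛ x * x - (c + B * (y * y))) →
                ∃₂ λ s r → ¬ P ∣ₛ r × P ∣ₛ c * (r * r) - (s * s - B)
    represent (x , y , P∣x²-[c+By²]) =
      let w , P∣yw-1 = inverse P∤y
          P∤w : ¬ P ∣ₛ w
          P∤w P∣w = P∤1 (∣ₛ-respʳ (m-[m-n]≡n (y * w) (+ 1))
                          (Signed.∣m∣n⇒∣m-n (Signed.∣n⇒∣m*n y P∣w) P∣yw-1))
      in x * w , w , P∤w , ∣ₛ-lincomb (- (w * w)) (- (B * (y * w + + 1)))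
                             P∣x²-[c+By²] P∣yw-1 (cw²-[[xw]²-B]≡ c B x y w)
      where
      P∤y : ¬ P ∣ₛ y
      P∤y P∣y = nsq (x , ∣ₛ-lincomb (+ 1) (B * y) P∣x²-[c+By²] P∣y (x²-c≡ x c B y))

  valuation : ∀ {b} → b ≢ + 0 → ∃₂ λ k b′ → b ≡ P ^ k * b′ × ¬ P ∣ₛ b′
  valuation {b} b≢0 = go (suc ∣ b ∣) b ℕP.≤-refl b≢0 (P Signed.∣? b)
    where
    go : ∀ fuel b → ∣ b ∣ ℕ.< fuel → b ≢ + 0 → Dec (P ∣ₛ b) →
         ∃₂ λ k b′ → b ≡ P ^ k * b′ × ¬ P ∣ₛ b′
    go _          b _ _ (no P∤b) = 0 , b , sym (ℤP.*-identityˡ b) , P∤b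
    go (suc fuel) _ |qP|<1+fuel qP≢0 (yes (divides q refl)) =
      let k , b′ , q≡ , P∤b′ = go fuel q |q|<fuel q≢0 (P Signed.∣? q)
      in suc k , b′ , trans (cong (_* P) q≡) (reassoc (P ^ k) b′ P) , P∤b′
      where
      reassoc : ∀ X b P → X * b * P ≡ P * X * b
      reassoc = solve-∀
      q≢0 : q ≢ + 0
      q≢0 q≡0 = qP≢0 (trans (cong (_* P) q≡0) (ℤP.*-zeroˡ P))
      |q|<|qP| : ∣ q ∣ ℕ.< ∣ q * P ∣
      |q|<|qP| = subst (∣ q ∣ ℕ.<_) (sym (ℤP.abs-* q P))
        (ℕP.m<m*n ∣ q ∣ p {{ℕ.≢-nonZero (q≢0 ∘ ℤP.∣i∣≡0⇒i≡0)}} 1<p)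
      |q|<fuel : ∣ q ∣ ℕ.< fuel
      |q|<fuel = ℕP.<-≤-trans |q|<|qP| (ℕ.s≤s⁻¹ |qP|<1+fuel)

  valuationIs : ∀ {b k b′} → b ≡ P ^ k * b′ → ¬ P ∣ₛ b′ → ValuationIs p b k
  valuationIs {b} {k} {b′} b≡ P∤b′ =
    ∣⇒∣ᵤ (divides b′ (trans b≡ (ℤP.*-comm (P ^ k) b′))) ,
    λ P^[1+k]∣b → P∤b′ (P^[1+n]∣P^n*x⇒P∣x k (∣ₛ-respʳ b≡ (∣ᵤ⇒∣ {P ^ suc k} P^[1+k]∣b)))

  -- Hensel's lemma

  hensel : ∀ {A c r} → ¬ P ∣ₛ A → ¬ P ∣ₛ r → P ∣ₛ A * (r * r) - c →
           Σ (ℤₚ p) λ x → ∀ n → P ^ n ∣ₛ A * (digitSeq x n * digitSeq x n) - c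
  hensel {A} {c} {r} P∤A P∤r P∣Ar²-c =
    record { digitSeq = x ; compat = λ n → ∣⇒∣ᵤ (P^n∣x[1+n]-x[n] n) } ,
    λ n → P^[1+n]∣⇒P^n∣ n (proj₁ (invariant n))
    where
    w : ℤ
    w = proj₁ (inverse (P∤x*y (P∤x*y P∤2 P∤A) P∤r))
    P∣2Arw-1 : P ∣ₛ + 2 * A * r * w - + 1
    P∣2Arw-1 = proj₂ (inverse (P∤x*y (P∤x*y P∤2 P∤A) P∤r))
    error : ℤ → ℤ
    error y = A * (y * y) - c
    -- Newton's iteration with the derivative frozen at r: as x ≡ r, each step multiplies
    -- the error by a multiple of p.
    x : ℕ → ℤ
    x zero    = r
    x (suc n) = x n - error (x n) * w
    newton-error≡ : ∀ A c r w y →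
      A * ((y - (A * (y * y) - c) * w) * (y - (A * (y * y) - c) * w)) - c
      ≡ (A * (y * y) - c) * (- (+ 2 * A * r * w - + 1) - + 2 * A * w * (y - r))
        + A * w * w * ((A * (y * y) - c) * (A * (y * y) - c))
    newton-error≡ = solve-∀
    newton-drift≡ : ∀ y e w r → y - e * w - r ≡ (y - r) - w * e
    newton-drift≡ = solve-∀
    invariant : ∀ n → P ^ suc n ∣ₛ error (x n) × P ∣ₛ x n - r
    invariant zero    = P∣⇒P^1∣ P∣Ar²-c , ∣ₛ-respʳ (sym (ℤP.+-inverseʳ r)) (∣ᵤ⇒∣ (p ℕ.∣0))
    invariant (suc n) =
      ∣ₛ-respʳ (sym (newton-error≡ A c r w (x n))) P^[2+n]∣error , P∣x[1+n]-r
      where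
      e = error (x n)
      P^[1+n]∣e : P ^ suc n ∣ₛ e
      P^[1+n]∣e = proj₁ (invariant n)
      P∣xₙ-r : P ∣ₛ x n - r
      P∣xₙ-r = proj₂ (invariant n)
      P∣factor : P ∣ₛ - (+ 2 * A * r * w - + 1) - + 2 * A * w * (x n - r)
      P∣factor =
        Signed.∣m∣n⇒∣m-n (Signed.∣m⇒∣-m P∣2Arw-1) (Signed.∣n⇒∣m*n (+ 2 * A * w) P∣xₙ-r)
      2+n≤2[1+n] : suc (suc n) ℕ.≤ 2 ℕ.* suc n
      2+n≤2[1+n] = subst (suc (suc n) ℕ.≤_) (sym (ℕP.*-suc 2 n)) (s≤s (s≤s (ℕP.m≤n*m n 2)))
      P^[2+n]∣error : P ^ suc (suc n) ∣ₛ
        e * (- (+ 2 * A * r * w - + 1) - + 2 * A * w * (x n - r)) + A * w * w * (e * e)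
      P^[2+n]∣error = Signed.∣m∣n⇒∣m+n (P^m∣x⇒P∣y⇒P^[1+m]∣x*y (suc n) P^[1+n]∣e P∣factor)
        (Signed.∣n⇒∣m*n (A * w * w)
          (Signed.∣-trans (P^m∣P^n 2+n≤2[1+n]) (P^m∣x⇒P^[2m]∣x*x (suc n) P^[1+n]∣e)))
      P∣x[1+n]-r : P ∣ₛ x (suc n) - r
      P∣x[1+n]-r = ∣ₛ-respʳ (sym (newton-drift≡ (x n) e w r))
        (Signed.∣m∣n⇒∣m-n P∣xₙ-r (Signed.∣n⇒∣m*n w (P^[1+n]∣⇒P∣ n P^[1+n]∣e)))
    P^n∣x[1+n]-x[n] : ∀ n → P ^ n ∣ₛ x (suc n) - x n
    P^n∣x[1+n]-x[n] n = ∣ₛ-respʳ (sym (step≡ (x n) (error (x n)) w))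
      (Signed.∣m⇒∣-m (Signed.∣n⇒∣m*n w (P^[1+n]∣⇒P^n∣ n (proj₁ (invariant n)))))
      where
      step≡ : ∀ y e w → y - e * w - y ≡ - (w * e)
      step≡ = solve-∀

-- The curve

module Curve (p : ℕ) (p-prime : Prime p) (2<p : 2 ℕ.< p) (a b d e : ℤ)
             (P∣b : + p ∣ₛ b) (P∤a : ¬ + p ∣ₛ a) (de≡a²-4b : d * e ≡ a * a - + 4 * b) where

  open ModPrime p p-prime 2<p public
  open ≡-Reasoning

  Point : Set
  Point = HasQpPoint p d e (- (+ 2 * a))

  curve : ℤ → ℤ → ℤ → ℤ
  curve U V Z = Z * Z - (d * (U ^ 4) + - (+ 2 * a) * (U * U) * (V * V) + e * (V ^ 4))

  W : ℤ → ℤ → ℤ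
  W U V = d * (U * U) - a * (V * V)

  completed : ℤ → ℤ → ℤ → ℤ
  completed U V Z = d * (Z * Z) - W U V * W U V + + 4 * b * (V * V * (V * V))

  d*curve≡completed : ∀ U V Z → d * curve U V Z ≡ completed U V Z
  d*curve≡completed U V Z = begin
    d * curve U V Z
      ≡⟨ cong₂ (λ U⁴ V⁴ → d * (Z * Z - (d * U⁴ + - (+ 2 * a) * (U * U) * (V * V) + e * V⁴)))
               (x^4≡x²*x² U) (x^4≡x²*x² V) ⟩
    d * (Z * Z - (d * (U * U * (U * U)) + - (+ 2 * a) * (U * U) * (V * V) + e * V⁴))
      ≡⟨ complete-square a d e U V Z ⟩
    d * (Z * Z) - W U V * W U V + (a * a - d * e) * V⁴
      ≡⟨ cong (λ de → d * (Z * Z) - W U V * W U V + (a * a - de) * V⁴) de≡a²-4b ⟩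
    d * (Z * Z) - W U V * W U V + (a * a - (a * a - + 4 * b)) * V⁴
      ≡⟨ cong (λ k → d * (Z * Z) - W U V * W U V + k * V⁴) (m-[m-n]≡n (a * a) (+ 4 * b)) ⟩
    completed U V Z ∎
    where
    V⁴ = V * V * (V * V)
    complete-square : ∀ a d e U V Z →
      d * (Z * Z - (d * (U * U * (U * U)) + - (+ 2 * a) * (U * U) * (V * V)
                    + e * (V * V * (V * V))))
      ≡ d * (Z * Z) - (d * (U * U) - a * (V * V)) * (d * (U * U) - a * (V * V))
        + (a * a - d * e) * (V * V * (V * V))
    complete-square = solve-∀

  P∤d : ¬ P ∣ₛ d
  P∤d P∣d = P∤a (P∣x*x⇒P∣x (∣ₛ-lincomb e (+ 4) P∣d P∣b a²≡ed+4b))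
    where
    m≡m-n+n : ∀ m n → m ≡ m - n + n
    m≡m-n+n = solve-∀
    a²≡ed+4b : a * a ≡ e * d + + 4 * b
    a²≡ed+4b = trans (m≡m-n+n (a * a) (+ 4 * b))
      (cong (_+ + 4 * b) (trans (sym de≡a²-4b) (ℤP.*-comm d e)))

  ∣curve⇒∣completed : ∀ {k} U V Z → k ∣ₛ curve U V Z → k ∣ₛ completed U V Z
  ∣curve⇒∣completed U V Z k∣curve =
    ∣ₛ-respʳ (d*curve≡completed U V Z) (Signed.∣n⇒∣m*n d k∣curve)

  P^n∣completed⇒P^n∣curve : ∀ n U V Z → P ^ n ∣ₛ completed U V Z → P ^ n ∣ₛ curve U V Z
  P^n∣completed⇒P^n∣curve n U V Z P^n∣completed =
    P^n∣x*y⇒P^n∣y n P∤d (∣ₛ-respʳ (sym (d*curve≡completed U V Z)) P^n∣completed)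

  ∣completed⇒∣W²-dZ² : ∀ {k} U V Z → k ∣ₛ b → k ∣ₛ completed U V Z →
                       k ∣ₛ W U V * W U V - d * (Z * Z)
  ∣completed⇒∣W²-dZ² U V Z k∣b k∣completed = ∣ₛ-lincomb (- + 1) (+ 4 * (V * V * (V * V)))
    k∣completed k∣b (W²-dZ²≡ d b (W U V) Z (V * V * (V * V)))
    where
    W²-dZ²≡ : ∀ d b W Z V⁴ →
      W * W - d * (Z * Z) ≡ - + 1 * (d * (Z * Z) - W * W + + 4 * b * V⁴) + + 4 * V⁴ * b
    W²-dZ²≡ = solve-∀

  module Obstruction (nsq-d : NonSquareMod d) (u v z : ℤₚ p)
    (nondivisible : ¬ (((+ p) ∣ digitSeq u 1) × ((+ p) ∣ digitSeq v 1)))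
    (solves : ∀ n → (+ p) ^ n ∣ curve (digitSeq u n) (digitSeq v n) (digitSeq z n)) where

    U V Z : ℕ → ℤ
    U = digitSeq u
    V = digitSeq v
    Z = digitSeq z

    P^n∣completed : ∀ n → P ^ n ∣ₛ completed (U n) (V n) (Z n)
    P^n∣completed n = ∣curve⇒∣completed (U n) (V n) (Z n) (∣ᵤ⇒∣ {P ^ n} (solves n))

    P∣W : ∀ n → P ∣ₛ W (U (suc n)) (V (suc n))
    P∣W n = proj₁ (nonSquare-anisotropic nsq-d (W (U (suc n)) (V (suc n))) (Z (suc n))
      (∣completed⇒∣W²-dZ² (U (suc n)) (V (suc n)) (Z (suc n)) P∣b
        (P^[1+n]∣⇒P∣ n (P^n∣completed (suc n)))))

    P∤V : ∀ n → ¬ P ∣ₛ V (suc n)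
    P∤V n P∣V = nondivisible
      (∣⇒∣ᵤ (P∣digit[1+n]⇒P∣digit₁ u n P∣U) , ∣⇒∣ᵤ (P∣digit[1+n]⇒P∣digit₁ v n P∣V))
      where
      dU²≡ : ∀ d U a V → d * (U * U) ≡ + 1 * (d * (U * U) - a * (V * V)) + a * V * V
      dU²≡ = solve-∀
      P∣U : P ∣ₛ U (suc n)
      P∣U = P∣x*x⇒P∣x ([ flip contradiction P∤d , id ]′ (P∣x*y⇒P∣x⊎P∣y d (U (suc n) * U (suc n))
        (∣ₛ-lincomb (+ 1) (a * V (suc n)) (P∣W n) P∣V (dU²≡ d (U (suc n)) a (V (suc n))))))

    a-nonSquare : NonSquareMod a
    a-nonSquare (t , P∣t²-a) =
      [ flip contradiction P∤a ∘ P∣t⇒P∣a , P∤V 0 ]′ (P∣x*y⇒P∣x⊎P∣y t (V 1) P∣tV)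
      where
      [tV]²-dU²≡ : ∀ t V d U a → t * V * (t * V) - d * (U * U)
                   ≡ V * V * (t * t - a) + - + 1 * (d * (U * U) - a * (V * V))
      [tV]²-dU²≡ = solve-∀
      P∣tV : P ∣ₛ t * V 1
      P∣tV = proj₁ (nonSquare-anisotropic nsq-d (t * V 1) (U 1)
        (∣ₛ-lincomb (V 1 * V 1) (- + 1) P∣t²-a (P∣W 0) ([tV]²-dU²≡ t (V 1) d (U 1) a)))
      a≡ : ∀ t a → a ≡ t * t + - + 1 * (t * t - a)
      a≡ = solve-∀
      P∣t⇒P∣a : P ∣ₛ t → P ∣ₛ a
      P∣t⇒P∣a P∣t = ∣ₛ-lincomb t (- + 1) P∣t P∣t²-a (a≡ t a)

    valuation-not-odd : ∀ m → ¬ ValuationIs p b (suc (2 ℕ.* m))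
    valuation-not-odd m (P^k∣b , P^[1+k]∤b) = P^[1+k]∤b (∣⇒∣ᵤ P^[1+k]∣b)
      where
      k = suc (2 ℕ.* m)
      Uₙ = U (suc k)
      Vₙ = V (suc k)
      Zₙ = Z (suc k)
      P^[1+k]∣completed : P ^ suc k ∣ₛ completed Uₙ Vₙ Zₙ
      P^[1+k]∣completed = P^n∣completed (suc k)
      P^[1+m]∣W×Z : P ^ suc m ∣ₛ W Uₙ Vₙ × P ^ suc m ∣ₛ Zₙ
      P^[1+m]∣W×Z = nonSquare-anisotropic-^ nsq-d m (W Uₙ Vₙ) Zₙ
        (∣completed⇒∣W²-dZ² Uₙ Vₙ Zₙ (∣ᵤ⇒∣ {P ^ k} P^k∣b) (P^[1+n]∣⇒P^n∣ k P^[1+k]∣completed))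
      P^[1+m]∣⇒P^[1+k]∣² : ∀ {x} → P ^ suc m ∣ₛ x → P ^ suc k ∣ₛ x * x
      P^[1+m]∣⇒P^[1+k]∣² {x} P^[1+m]∣x =
        subst (λ j → P ^ j ∣ₛ x * x) (ℕP.*-suc 2 m) (P^m∣x⇒P^[2m]∣x*x (suc m) P^[1+m]∣x)
      4V⁴b≡ : ∀ d b W Z V⁴ → + 4 * V⁴ * b ≡ d * (Z * Z) - W * W + + 4 * b * V⁴ - d * (Z * Z) + W * W
      4V⁴b≡ = solve-∀
      P^[1+k]∣4V⁴b : P ^ suc k ∣ₛ + 4 * (Vₙ * Vₙ * (Vₙ * Vₙ)) * b
      P^[1+k]∣4V⁴b = ∣ₛ-respʳ (sym (4V⁴b≡ d b (W Uₙ Vₙ) Zₙ (Vₙ * Vₙ * (Vₙ * Vₙ))))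
        (Signed.∣m∣n⇒∣m+n
          (Signed.∣m∣n⇒∣m-n P^[1+k]∣completed
            (Signed.∣n⇒∣m*n d (P^[1+m]∣⇒P^[1+k]∣² (proj₂ P^[1+m]∣W×Z))))
          (P^[1+m]∣⇒P^[1+k]∣² (proj₁ P^[1+m]∣W×Z)))
      P∤V² = P∤x*y (P∤V k) (P∤V k)
      P^[1+k]∣b : P ^ suc k ∣ₛ b
      P^[1+k]∣b = P^n∣x*y⇒P^n∣y (suc k) (P∤x*y P∤4 (P∤x*y P∤V² P∤V²)) P^[1+k]∣4V⁴b

  no-point-if-a-square : NonSquareMod d → SquareMod a → ¬ Point
  no-point-if-a-square nsq-d sq-a (u , v , z , nondivisible , solves) =
    Obstruction.a-nonSquare nsq-d u v z nondivisible solves sq-a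

  no-point-if-odd-valuation : NonSquareMod d → ∀ m → ValuationIs p b (suc (2 ℕ.* m)) → ¬ Point
  no-point-if-odd-valuation nsq-d m val (u , v , z , nondivisible , solves) =
    Obstruction.valuation-not-odd nsq-d u v z nondivisible solves m val

  point-if-d-square : SquareMod d → Point
  point-if-d-square (x , P∣x²-d) =
    lift (hensel P∤1 P∤x (∣ₛ-respʳ (cong (_- d) (sym (ℤP.*-identityˡ (x * x)))) P∣x²-d))
    where
    d≡ : ∀ x d → d ≡ x * x + - + 1 * (x * x - d)
    d≡ = solve-∀
    P∤x : ¬ P ∣ₛ x
    P∤x P∣x = P∤d (∣ₛ-lincomb x (- + 1) P∣x P∣x²-d (d≡ x d))
    curve[1,0,Z]≡ : ∀ a d e Z → + 1 * (Z * Z) - d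
                    ≡ Z * Z - (d * + 1 + - (+ 2 * a) * (+ 1 * + 1) * (+ 0 * + 0) + e * + 0)
    curve[1,0,Z]≡ = solve-∀
    lift : (Σ (ℤₚ p) λ z → ∀ n → P ^ n ∣ₛ + 1 * (digitSeq z n * digitSeq z n) - d) → Point
    lift (z , z-solves) = constant (+ 1) , constant (+ 0) , z , P∤1 ∘ ∣ᵤ⇒∣ ∘ proj₁ ,
      λ n → ∣⇒∣ᵤ (∣ₛ-respʳ (curve[1,0,Z]≡ a d e (digitSeq z n)) (z-solves n))

  point-if-b≡Q²b′ : NonSquareMod d → NonSquareMod a → ∀ {Q b′} →
                    P ∣ₛ Q → ¬ P ∣ₛ b′ → b ≡ Q * Q * b′ → Point
  point-if-b≡Q²b′ nsq-d nsq-a {Q} {b′} P∣Q P∤b′ b≡Q²b′ =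
    build (nonSquare-represented nsq-d (P∤x*y P∤4 P∤b′)) (nonSquare-ratio-square nsq-a nsq-d)
    where
    dt²-[a+QW₀]≡ : ∀ d t a Q W₀ → d * (t * t) - (a + Q * W₀) ≡ + 1 * (d * (t * t) - a) + - W₀ * Q
    dt²-[a+QW₀]≡ = solve-∀
    a≡ : ∀ d t a → a ≡ d * t * t + - + 1 * (d * (t * t) - a)
    a≡ = solve-∀
    -- With ε = dU² − (a + QW₀) we have W U 1 = QW₀ + ε, so only multiples of ε survive
    -- besides Q² (dY² − (W₀² − 4b′)).
    completed-identity : ∀ d a Q b′ W₀ U Y →
      d * (Q * Y * (Q * Y)) - (d * (U * U) - a * (+ 1 * + 1)) * (d * (U * U) - a * (+ 1 * + 1))
        + + 4 * (Q * Q * b′) * (+ 1 * + 1 * (+ 1 * + 1))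
      ≡ Q * Q * (d * (Y * Y) - (W₀ * W₀ - + 4 * b′))
        + - (d * (U * U) - (a + Q * W₀) + + 2 * Q * W₀) * (d * (U * U) - (a + Q * W₀))
    completed-identity = solve-∀
    build : (∃₂ λ W₀ r → ¬ P ∣ₛ r × P ∣ₛ d * (r * r) - (W₀ * W₀ - + 4 * b′)) →
            (∃[ t ] P ∣ₛ d * (t * t) - a) → Point
    build (W₀ , r , P∤r , P∣dr²-[W₀²-4b′]) (t , P∣dt²-a) =
      lift (hensel P∤d P∤r P∣dr²-[W₀²-4b′]) (hensel P∤d P∤t P∣dt²-[a+QW₀])
      where
      P∤t : ¬ P ∣ₛ t
      P∤t P∣t = P∤a (∣ₛ-lincomb (d * t) (- + 1) P∣t P∣dt²-a (a≡ d t a))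
      P∣dt²-[a+QW₀] : P ∣ₛ d * (t * t) - (a + Q * W₀)
      P∣dt²-[a+QW₀] = ∣ₛ-lincomb (+ 1) (- W₀) P∣dt²-a P∣Q (dt²-[a+QW₀]≡ d t a Q W₀)
      lift : (Σ (ℤₚ p) λ Y → ∀ n → P ^ n ∣ₛ d * (digitSeq Y n * digitSeq Y n) - (W₀ * W₀ - + 4 * b′))
           → (Σ (ℤₚ p) λ U → ∀ n → P ^ n ∣ₛ d * (digitSeq U n * digitSeq U n) - (a + Q * W₀))
           → Point
      lift (Y , Y-solves) (U , U-solves) = U , constant (+ 1) , scale Q Y , P∤1 ∘ ∣ᵤ⇒∣ ∘ proj₂ ,
        λ n → ∣⇒∣ᵤ (P^n∣completed⇒P^n∣curve n (digitSeq U n) (+ 1) (Q * digitSeq Y n)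
                                           (P^n∣completed n))
        where
        P^n∣completed : ∀ n → P ^ n ∣ₛ completed (digitSeq U n) (+ 1) (Q * digitSeq Y n)
        P^n∣completed n = ∣ₛ-lincomb (Q * Q) (- (ε + + 2 * Q * W₀)) (Y-solves n) (U-solves n) (begin
          completed Uₙ (+ 1) (Q * Yₙ)
            ≡⟨ cong (λ β → d * (Q * Yₙ * (Q * Yₙ)) - W Uₙ (+ 1) * W Uₙ (+ 1)
                           + + 4 * β * (+ 1 * + 1 * (+ 1 * + 1))) b≡Q²b′ ⟩
          d * (Q * Yₙ * (Q * Yₙ)) - W Uₙ (+ 1) * W Uₙ (+ 1)
            + + 4 * (Q * Q * b′) * (+ 1 * + 1 * (+ 1 * + 1))
            ≡⟨ completed-identity d a Q b′ W₀ Uₙ Yₙ ⟩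
          Q * Q * (d * (Yₙ * Yₙ) - (W₀ * W₀ - + 4 * b′)) + - (ε + + 2 * Q * W₀) * ε ∎)
          where
          Uₙ = digitSeq U n
          Yₙ = digitSeq Y n
          ε = d * (Uₙ * Uₙ) - (a + Q * W₀)

  no-point⇒odd-valuation⊎a-square : b ≢ + 0 → NonSquareMod d → ¬ Point →
    (∃ λ k → ValuationIs p b k × OddNat k) ⊎ legendre a p ≡ + 1
  no-point⇒odd-valuation⊎a-square b≢0 nsq-d no-point =
    let k , b′ , b≡P^kb′ , P∤b′ = valuation b≢0 in by-parity k b′ b≡P^kb′ P∤b′ (even⊎odd k)
    where
    by-parity : ∀ k b′ → b ≡ P ^ k * b′ → ¬ P ∣ₛ b′ → (∃[ m ] k ≡ 2 ℕ.* m) ⊎ OddNat k →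
                (∃ λ k → ValuationIs p b k × OddNat k) ⊎ legendre a p ≡ + 1
    by-parity k b′ b≡P^kb′ P∤b′ (inj₂ k-odd) = inj₁ (k , valuationIs {k = k} b≡P^kb′ P∤b′ , k-odd)
    by-parity _ b′ b≡b′ P∤b′ (inj₁ (zero , refl)) =
      contradiction (∣ₛ-respʳ (trans b≡b′ (ℤP.*-identityˡ b′)) P∣b) P∤b′
    by-parity _ b′ b≡P^[2+2m]b′ P∤b′ (inj₁ (suc m , refl)) with legendre a p | legendreView a
    ... | _ | divisible P∣a    = contradiction P∣a P∤a
    ... | _ | nonzero-square _ = inj₂ refl
    ... | _ | nonsquare nsq-a  = contradiction
      (point-if-b≡Q²b′ nsq-d nsq-a (P∣P^[1+n] m) P∤b′
        (trans b≡P^[2+2m]b′ (cong (_* b′) (P^[2m]≡P^m*P^m (suc m)))))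
      no-point

lemma4p1 : (a b : ℤ) → ¬ (b * (a * a - + 4 * b) ≡ + 0) →
  (p : ℕ) → Prime p → 3 ℕ.< p → (+ p) ∣ b → ¬ ((+ p) ∣ a) →
  (d e : ℤ) → d * e ≡ a * a - + 4 * b → gcd d e ≡ + 1 → SquareFree d →
  (¬ HasQpPoint p d e (- (+ 2 * a)))
    ⇔ ((legendre d p ≡ - (+ 1)) ×
       ((∃ λ k → ValuationIs p b k × OddNat k) ⊎ legendre a p ≡ + 1))
lemma4p1 a b b[a²-4b]≢0 p p-prime 3<p p∣b p∤a d e de≡a²-4b _ _ =
  mk⇔ no-point⇒conditions conditions⇒no-point
  where
  open Curve p p-prime (ℕP.<-trans (ℕP.n<1+n 2) 3<p) a b d e (∣ᵤ⇒∣ p∣b) (p∤a ∘ ∣⇒∣ᵤ) de≡a²-4b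

  b≢0 : b ≢ + 0
  b≢0 b≡0 = b[a²-4b]≢0 (cong (λ β → β * (a * a - + 4 * β)) b≡0)

  no-point⇒conditions : ¬ Point →
    legendre d p ≡ - + 1 × ((∃ λ k → ValuationIs p b k × OddNat k) ⊎ legendre a p ≡ + 1)
  no-point⇒conditions no-point with legendre d p | legendreView d
  ... | _ | divisible P∣d       = contradiction P∣d P∤d
  ... | _ | nonzero-square sq-d = contradiction (point-if-d-square sq-d) no-point
  ... | _ | nonsquare nsq-d     = refl , no-point⇒odd-valuation⊎a-square b≢0 nsq-d no-point

  conditions⇒no-point :
    legendre d p ≡ - + 1 × ((∃ λ k → ValuationIs p b k × OddNat k) ⊎ legendre a p ≡ + 1) → ¬ Point
  conditions⇒no-point (leg-d , inj₁ (_ , val , m , refl)) =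
    no-point-if-odd-valuation (legendre≡-1⇒nonSquare leg-d) m val
  conditions⇒no-point (leg-d , inj₂ leg-a) =
    no-point-if-a-square (legendre≡-1⇒nonSquare leg-d) (legendre≡1⇒square leg-a)
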